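{- Let $p\in\{0,1\}^m$. For every $n\ge0$, $g_p(n+1,m+1)\equiv 0\pmod{x+1}$ if and only if $g_p(n,m)\equiv 0\pmod{x+1}$ (congruences in $\mathbb{Z}[x]$). Moreover, if there exists $N_0\in\mathbb{N}$ such that $g_p(n,m)\not\equiv 0\pmod{x+1}$ for all $n>N_0$, then $p$ is evasive.
   Context: Alphabet $\{0,1\}$; $wt(s)$ is the number of 1's in $s$. The KMP automaton of $p$ has states $q_1,\dots,q_{m+1}$, initial state $q_1$; after reading a string $s$ it is in state $q_{m+1}$ if $p$ occurs as a contiguous substring of $s$, and otherwise in state $q_i$ where $i-1$ is the largest length of a suffix of $s$ equal to a prefix of $p$. $U_p(n,i)$ is the set of $s\in\{0,1\}^n$ on which the automaton ends in $q_i$, and $g_p(n,i)=\sum_{s\in U_p(n,i)}x^{wt(s)}\in\mathbb{Z}[x]$. $D_p(n)$ is the deterministic decision tree complexity of deciding whether $p$ is a substring of an unknown $s\in\{0,1\}^n$ (minimum over correct deterministic adaptive query algorithms of the worst-case number of bits queried); $p$ is evasive if there exists $N_0$ with $D_p(n)=n$ for all $n>N_0$. -}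

module Defs where

open import Data.Bool using (Bool; true; false; _∧_; _∨_; if_then_else_)
open import Data.Nat using (ℕ; zero; suc; _+_; _∸_; _⊔_; _≤ᵇ_; _≡ᵇ_; _≤_; _<_)
open import Data.Integer using (ℤ; +_) renaming (_+_ to _+ℤ_)
open import Data.List using (List; []; _∷_; length; drop; take; map; foldr; upTo; replicate; _++_; concatMap)
open import Data.Vec using (Vec; []; _∷_; toList; lookup)
open import Data.Fin using (Fin)
open import Data.Product using (Σ; ∃; _×_)
open import Relation.Binary.PropositionalEquality using (_≡_)

eqB : List Bool → List Bool → Bool
eqB [] [] = true
eqB (true ∷ a) (true ∷ b) = eqB a b
eqB (false ∷ a) (false ∷ b) = eqB a b
eqB _ _ = false

prefixB : List Bool → List Bool → Bool
prefixB p s = eqB (take (length p) s) p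

occurs : List Bool → List Bool → Bool
occurs p [] = prefixB p []
occurs p (b ∷ s) = prefixB p (b ∷ s) ∨ occurs p s

longestSufPre : List Bool → List Bool → ℕ
longestSufPre p s =
  foldr _⊔_ 0 (map (λ k → if (k ≤ᵇ length p) ∧ eqB (drop (length s ∸ k) s) (take k p) then k else 0)
                   (upTo (suc (length s))))

-- index i of the state q_i of the KMP automaton of p after reading s
kmpState : List Bool → List Bool → ℕ
kmpState p s = if occurs p s then suc (length p) else suc (longestSufPre p s)

wt : List Bool → ℕ
wt [] = 0
wt (true ∷ s) = suc (wt s)
wt (false ∷ s) = wt s

allVec : (n : ℕ) → List (Vec Bool n)
allVec zero = [] ∷ []
allVec (suc n) = concatMap (λ v → (false ∷ v) ∷ (true ∷ v) ∷ []) (allVec n)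

-- Polynomials in ℤ[x] as coefficient lists (constant coefficient first)

Poly : Set
Poly = List ℤ

addP : Poly → Poly → Poly
addP [] q = q
addP (a ∷ p) [] = a ∷ p
addP (a ∷ p) (b ∷ q) = (a +ℤ b) ∷ addP p q

coeff : Poly → ℕ → ℤ
coeff [] _ = + 0
coeff (a ∷ p) zero = a
coeff (a ∷ p) (suc k) = coeff p k

monomial : ℕ → Poly
monomial k = replicate k (+ 0) ++ (+ 1 ∷ [])

timesXPlus1 : Poly → Poly
timesXPlus1 q = addP q (+ 0 ∷ q)

DivByXPlus1 : Poly → Set
DivByXPlus1 P = ∃ λ (Q : Poly) → ∀ k → coeff P k ≡ coeff (timesXPlus1 Q) k

g : ∀ {m} → Vec Bool m → ℕ → ℕ → Poly
g p n i = foldr (λ s acc → if kmpState (toList p) (toList s) ≡ᵇ i then addP (monomial (wt (toList s))) acc else acc)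
                [] (allVec n)

data DTree (n : ℕ) : Set where
  leaf  : Bool → DTree n
  query : Fin n → DTree n → DTree n → DTree n

eval : ∀ {n} → DTree n → Vec Bool n → Bool
eval (leaf b) s = b
eval (query i t₀ t₁) s = if lookup s i then eval t₁ s else eval t₀ s

queries : ∀ {n} → DTree n → Vec Bool n → ℕ
queries (leaf b) s = 0
queries (query i t₀ t₁) s = suc (if lookup s i then queries t₁ s else queries t₀ s)

Decides : ∀ {m n} → Vec Bool m → DTree n → Set
Decides p t = ∀ s → eval t s ≡ occurs (toList p) (toList s)

DIs : ∀ {m} → Vec Bool m → (n k : ℕ) → Set
DIs p n k =
  (∃ λ (t : DTree n) → Decides p t × (∀ s → queries t s ≤ k)) ×
  (∀ (t : DTree n) → Decides p t → ∃ λ s → k ≤ queries t s)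

Evasive : ∀ {m} → Vec Bool m → Set
Evasive p = ∃ λ N₀ → ∀ n → N₀ < n → DIs p n n

-- Divisibility by x + 1 means vanishing at x = −1, and g_p(n,i)(−1) = Σ_{s ∈ U_p(n,i)} (−1)^wt(s).
-- Write a string of length n + 1 as l·b. If l contains p, so do l·0 and l·1, and their signs cancel;
-- otherwise l·b contains p exactly when l is in state q_m and b is the last letter of p.
-- Hence g_p(n+1,m+1)(−1) = ±g_p(n,m)(−1).
-- A decision tree deciding "p occurs" with fewer than n queries on every input splits {0,1}^n into
-- subcubes with a free coordinate, on each of which Σ (−1)^wt(s) = 0. So g_p(n,m+1)(−1) = 0, and by
-- the first part x + 1 divides g_p(n−1,m).

module Submission where

open import Defs
import Algebra.Properties.CommutativeSemigroup
open import Data.Bool using (Bool; true; false; not; _∧_; if_then_else_)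
open import Data.Bool.Properties using (∨-zeroʳ; ¬-not; not-¬; T-≡)
open import Data.Empty using (⊥-elim)
open import Data.Fin using (Fin; zero; suc)
open import Data.Integer using (ℤ; 0ℤ; 1ℤ; -1ℤ; _+_; _-_; _*_; _^_)
import Data.Integer.Properties as ℤ
open import Data.Integer.Tactic.RingSolver using (solve-∀)
open import Data.List using (List; []; _∷_; _++_; _∷ʳ_; [_]; length; take; drop; map; foldr; upTo; concatMap; initLast; _∷ʳ′_)
open import Data.List.Membership.Propositional using (_∈_)
open import Data.List.Membership.Propositional.Properties using (∈-map⁺; ∈-map⁻; ∈-upTo⁺; foldr-selective)
open import Data.List.Properties using (++-assoc; ++-identityʳ; length-++; take++drop≡id; take-all; ∷ʳ-injective; foldr-preservesᵇ; foldr-forcesᵇ)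
open import Data.List.Relation.Unary.All as All using (All)
open import Data.List.Relation.Unary.All.Properties using (map⁺)
open import Data.Maybe using (Maybe; just; nothing)
import Data.Nat as ℕ
open import Data.Nat using (ℕ; zero; suc; _∸_; _⊔_; _≤ᵇ_; _≡ᵇ_; _≤_; _<_; _≟_; _≤?_; z≤n; s≤s)
open import Data.Nat.Properties using (≤ᵇ⇒≤; ≤⇒≤ᵇ; ≡ᵇ⇒≡; ≡⇒≡ᵇ; +-comm; m≤m+n; m≤n+m; m+n∸n≡m; ≤-refl; ≤-reflexive; ≤-antisym; ≤-pred; <-trans; n<1+n; <⇒≤pred; ≤∧≢⇒<; <⇒≢; ≰⇒>; 1+n≢n; suc-injective; ⊔-lub; ⊔-sel; m⊔n≤o⇒m≤o; m⊔n≤o⇒n≤o)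
open import Data.Product using (∃; ∃₂; _×_; _,_; proj₁; proj₂)
open import Data.Sum using (_⊎_; inj₁; inj₂; [_,_]′)
open import Data.Unit using (⊤; tt)
import Data.Vec as Vec
open import Data.Vec using (Vec; lookup; replicate; toList; _[_]≔_) renaming ([] to []ᵥ; _∷_ to _∷ᵥ_; _∷ʳ_ to _∷ʳᵥ_)
open import Data.Vec.Properties using (toList-∷ʳ; length-toList)
open import Function using (id; _∘_)
open import Function.Bundles using (_⇔_; mk⇔; Equivalence)
import Function.Properties.Equivalence as ⇔
open import Relation.Binary.PropositionalEquality using (_≡_; _≢_; refl; sym; trans; cong; cong₂; subst; subst₂; module ≡-Reasoning)
open import Relation.Nullary using (¬_; Dec; yes; no)
open import Relation.Nullary.Decidable using (map′; _⊎-dec_)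

open ≡-Reasoning
open Algebra.Properties.CommutativeSemigroup ℤ.+-commutativeSemigroup using (interchange)

_≈ₚ_ : Poly → Poly → Set
P ≈ₚ Q = ∀ k → coeff P k ≡ coeff Q k

valueAt-1 : Poly → ℤ
valueAt-1 []      = 0ℤ
valueAt-1 (a ∷ P) = a - valueAt-1 P

valueAt-1-addP : ∀ P Q → valueAt-1 (addP P Q) ≡ valueAt-1 P + valueAt-1 Q
valueAt-1-addP []      Q       = sym (ℤ.+-identityˡ (valueAt-1 Q))
valueAt-1-addP (a ∷ P) []      = sym (ℤ.+-identityʳ (valueAt-1 (a ∷ P)))
valueAt-1-addP (a ∷ P) (b ∷ Q) rewrite valueAt-1-addP P Q = −-distrib a b (valueAt-1 P) (valueAt-1 Q)
  where
  −-distrib : ∀ a b c d → (a + b) - (c + d) ≡ (a - c) + (b - d)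
  −-distrib = solve-∀

valueAt-1-timesXPlus1 : ∀ Q → valueAt-1 (timesXPlus1 Q) ≡ 0ℤ
valueAt-1-timesXPlus1 Q rewrite valueAt-1-addP Q (0ℤ ∷ Q) = cancel (valueAt-1 Q)
  where
  cancel : ∀ a → a + (0ℤ - a) ≡ 0ℤ
  cancel = solve-∀

valueAt-1-≈ₚ[] : ∀ P → P ≈ₚ [] → valueAt-1 P ≡ 0ℤ
valueAt-1-≈ₚ[] []      P≈0 = refl
valueAt-1-≈ₚ[] (a ∷ P) P≈0 rewrite P≈0 0 | valueAt-1-≈ₚ[] P (λ k → P≈0 (suc k)) = refl

valueAt-1-cong : ∀ P Q → P ≈ₚ Q → valueAt-1 P ≡ valueAt-1 Q
valueAt-1-cong []      Q       P≈Q = sym (valueAt-1-≈ₚ[] Q (λ k → sym (P≈Q k)))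
valueAt-1-cong (a ∷ P) []      P≈Q = valueAt-1-≈ₚ[] (a ∷ P) P≈Q
valueAt-1-cong (a ∷ P) (b ∷ Q) P≈Q
  rewrite P≈Q 0 | valueAt-1-cong P Q (λ k → P≈Q (suc k)) = refl

valueAt-1-monomial : ∀ k → valueAt-1 (monomial k) ≡ -1ℤ ^ k
valueAt-1-monomial zero    = refl
valueAt-1-monomial (suc k) rewrite valueAt-1-monomial k =
  trans (ℤ.+-identityˡ _) (sym (ℤ.-1*i≡-i (-1ℤ ^ k)))

-- divX+1 c P is the quotient of P − c by x + 1 (synthetic division); it is exact when P(−1) = c.
divX+1 : ℤ → Poly → Poly
divX+1 c []      = []
divX+1 c (a ∷ P) = (a - c) ∷ divX+1 (a - c) P

divX+1-correct : ∀ c P → valueAt-1 P ≡ c → P ≈ₚ addP (divX+1 c P) (c ∷ divX+1 c P)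
divX+1-correct c []      P[-1]≡c zero    = P[-1]≡c
divX+1-correct c []      P[-1]≡c (suc k) = refl
divX+1-correct c (a ∷ P) P[-1]≡c zero    = split a c
  where
  split : ∀ a c → a ≡ (a - c) + c
  split = solve-∀
divX+1-correct c (a ∷ P) P[-1]≡c (suc k) =
  divX+1-correct (a - c) P (trans (solve a (valueAt-1 P)) (cong (λ e → a - e) P[-1]≡c)) k
  where
  solve : ∀ a e → e ≡ a - (a - e)
  solve = solve-∀

divByXPlus1⇔valueAt-1≡0 : ∀ P → DivByXPlus1 P ⇔ valueAt-1 P ≡ 0ℤ
divByXPlus1⇔valueAt-1≡0 P = mk⇔
  (λ (Q , P≈Q[x+1]) → trans (valueAt-1-cong P (timesXPlus1 Q) P≈Q[x+1]) (valueAt-1-timesXPlus1 Q))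
  (λ P[-1]≡0 → divX+1 0ℤ P , divX+1-correct 0ℤ P P[-1]≡0)

sign : List Bool → ℤ
sign s = -1ℤ ^ wt s

-- Coordinates marked just b are fixed to b; those marked nothing are free.
Subcube : ℕ → Set
Subcube n = Vec (Maybe Bool) n

sumOver : ∀ {n} → Subcube n → (Vec Bool n → ℤ) → ℤ
sumOver []ᵥ            f = f []ᵥ
sumOver (nothing ∷ᵥ ρ) f = sumOver ρ (λ s → f (false ∷ᵥ s)) + sumOver ρ (λ s → f (true ∷ᵥ s))
sumOver (just b ∷ᵥ ρ)  f = sumOver ρ (λ s → f (b ∷ᵥ s))

sumAll : ∀ n → (Vec Bool n → ℤ) → ℤ
sumAll n = sumOver (replicate n nothing)

_∈ᶜ_ : ∀ {n} → Vec Bool n → Subcube n → Set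
[]ᵥ      ∈ᶜ []ᵥ            = ⊤
(b ∷ᵥ s) ∈ᶜ (nothing ∷ᵥ ρ) = s ∈ᶜ ρ
(b ∷ᵥ s) ∈ᶜ (just c ∷ᵥ ρ)  = b ≡ c × s ∈ᶜ ρ

dim : ∀ {n} → Subcube n → ℕ
dim []ᵥ            = 0
dim (nothing ∷ᵥ ρ) = suc (dim ρ)
dim (just b ∷ᵥ ρ)  = dim ρ

fix : ∀ {n} → Subcube n → Fin n → Bool → Subcube n
fix ρ i b = ρ [ i ]≔ just b

dim-replicate : ∀ n → dim (replicate n nothing) ≡ n
dim-replicate zero    = refl
dim-replicate (suc n) = cong suc (dim-replicate n)

subcube-inhabited : ∀ {n} (ρ : Subcube n) → ∃ λ s → s ∈ᶜ ρ
subcube-inhabited []ᵥ            = []ᵥ , tt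
subcube-inhabited (nothing ∷ᵥ ρ) = let s , s∈ρ = subcube-inhabited ρ in false ∷ᵥ s , s∈ρ
subcube-inhabited (just b ∷ᵥ ρ)  = let s , s∈ρ = subcube-inhabited ρ in b ∷ᵥ s , refl , s∈ρ

lookup-∈ᶜ : ∀ {n} (ρ : Subcube n) i {b} s → lookup ρ i ≡ just b → s ∈ᶜ ρ → lookup s i ≡ b
lookup-∈ᶜ (just c ∷ᵥ ρ)  zero    (x ∷ᵥ s) refl (x≡c , _) = x≡c
lookup-∈ᶜ (nothing ∷ᵥ ρ) (suc i) (x ∷ᵥ s) ρᵢ≡b s∈ρ       = lookup-∈ᶜ ρ i s ρᵢ≡b s∈ρ
lookup-∈ᶜ (just c ∷ᵥ ρ)  (suc i) (x ∷ᵥ s) ρᵢ≡b (_ , s∈ρ) = lookup-∈ᶜ ρ i s ρᵢ≡b s∈ρ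

∈ᶜ-fix : ∀ {n} (ρ : Subcube n) i b s → lookup ρ i ≡ nothing → s ∈ᶜ fix ρ i b → s ∈ᶜ ρ × lookup s i ≡ b
∈ᶜ-fix (nothing ∷ᵥ ρ) zero    b (x ∷ᵥ s) _    (refl , s∈ρ) = s∈ρ , refl
∈ᶜ-fix (nothing ∷ᵥ ρ) (suc i) b (x ∷ᵥ s) ρᵢ≡∅ s∈ρ          = ∈ᶜ-fix ρ i b s ρᵢ≡∅ s∈ρ
∈ᶜ-fix (just c ∷ᵥ ρ)  (suc i) b (x ∷ᵥ s) ρᵢ≡∅ (x≡c , s∈ρ) =
  let s∈ρ′ , sᵢ≡b = ∈ᶜ-fix ρ i b s ρᵢ≡∅ s∈ρ in (x≡c , s∈ρ′) , sᵢ≡b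

dim-fix : ∀ {n} (ρ : Subcube n) i b → lookup ρ i ≡ nothing → dim ρ ≡ suc (dim (fix ρ i b))
dim-fix (nothing ∷ᵥ ρ) zero    b _    = refl
dim-fix (nothing ∷ᵥ ρ) (suc i) b ρᵢ≡∅ = cong suc (dim-fix ρ i b ρᵢ≡∅)
dim-fix (just c ∷ᵥ ρ)  (suc i) b ρᵢ≡∅ = dim-fix ρ i b ρᵢ≡∅

sumOver-cong : ∀ {n} (ρ : Subcube n) {f h} → (∀ s → s ∈ᶜ ρ → f s ≡ h s) → sumOver ρ f ≡ sumOver ρ h
sumOver-cong []ᵥ            f≗h = f≗h []ᵥ tt
sumOver-cong (nothing ∷ᵥ ρ) f≗h =
  cong₂ _+_ (sumOver-cong ρ (λ s → f≗h (false ∷ᵥ s))) (sumOver-cong ρ (λ s → f≗h (true ∷ᵥ s)))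
sumOver-cong (just b ∷ᵥ ρ)  f≗h = sumOver-cong ρ (λ s s∈ρ → f≗h (b ∷ᵥ s) (refl , s∈ρ))

sumAll-cong : ∀ n {f h : Vec Bool n → ℤ} → (∀ s → f s ≡ h s) → sumAll n f ≡ sumAll n h
sumAll-cong n f≗h = sumOver-cong (replicate n nothing) (λ s _ → f≗h s)

sumOver-zero : ∀ {n} (ρ : Subcube n) → sumOver ρ (λ _ → 0ℤ) ≡ 0ℤ
sumOver-zero []ᵥ            = refl
sumOver-zero (nothing ∷ᵥ ρ) rewrite sumOver-zero ρ = refl
sumOver-zero (just b ∷ᵥ ρ)  = sumOver-zero ρ

sumOver-scale : ∀ {n} (ρ : Subcube n) c f → sumOver ρ (λ s → c * f s) ≡ c * sumOver ρ f
sumOver-scale []ᵥ            c f = refl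
sumOver-scale (nothing ∷ᵥ ρ) c f
  rewrite sumOver-scale ρ c (λ s → f (false ∷ᵥ s)) | sumOver-scale ρ c (λ s → f (true ∷ᵥ s)) =
  sym (ℤ.*-distribˡ-+ c _ _)
sumOver-scale (just b ∷ᵥ ρ)  c f = sumOver-scale ρ c (λ s → f (b ∷ᵥ s))

sumOver-split : ∀ {n} (ρ : Subcube n) i f → lookup ρ i ≡ nothing →
                sumOver ρ f ≡ sumOver (fix ρ i false) f + sumOver (fix ρ i true) f
sumOver-split (nothing ∷ᵥ ρ) zero    f _ = refl
sumOver-split (nothing ∷ᵥ ρ) (suc i) f ρᵢ≡∅
  rewrite sumOver-split ρ i (λ s → f (false ∷ᵥ s)) ρᵢ≡∅ | sumOver-split ρ i (λ s → f (true ∷ᵥ s)) ρᵢ≡∅ =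
  interchange (half false false) (half true false) (half false true) (half true true)
  where
  half : Bool → Bool → ℤ
  half b c = sumOver (fix ρ i b) (λ s → f (c ∷ᵥ s))
sumOver-split (just b ∷ᵥ ρ)  (suc i) f ρᵢ≡∅ = sumOver-split ρ i (λ s → f (b ∷ᵥ s)) ρᵢ≡∅

sumOver-sign : ∀ {n} (ρ : Subcube n) → 0 < dim ρ → sumOver ρ (λ s → sign (toList s)) ≡ 0ℤ
sumOver-sign (nothing ∷ᵥ ρ) _ = begin
  Σρ + sumOver ρ (λ s → -1ℤ * sign (toList s))  ≡⟨ cong (Σρ +_) (sumOver-scale ρ -1ℤ (λ s → sign (toList s))) ⟩
  Σρ + -1ℤ * Σρ                                  ≡⟨ cong (Σρ +_) (ℤ.-1*i≡-i Σρ) ⟩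
  Σρ - Σρ                                        ≡⟨ ℤ.+-inverseʳ Σρ ⟩
  0ℤ                                             ∎
  where
  Σρ : ℤ
  Σρ = sumOver ρ (λ s → sign (toList s))
sumOver-sign (just false ∷ᵥ ρ) 0<dim = sumOver-sign ρ 0<dim
sumOver-sign (just true ∷ᵥ ρ)  0<dim =
  trans (sumOver-scale ρ -1ℤ (λ s → sign (toList s))) (cong (-1ℤ *_) (sumOver-sign ρ 0<dim))

sumAll-∷ʳ : ∀ n f → sumAll (suc n) f ≡ sumAll n (λ s → f (s ∷ʳᵥ false) + f (s ∷ʳᵥ true))
sumAll-∷ʳ zero    f = refl
sumAll-∷ʳ (suc n) f = cong₂ _+_ (sumAll-∷ʳ n (λ s → f (false ∷ᵥ s))) (sumAll-∷ʳ n (λ s → f (true ∷ᵥ s)))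

sumList : ∀ {A : Set} → (A → ℤ) → List A → ℤ
sumList f = foldr (λ x acc → f x + acc) 0ℤ

sumOver-+ : ∀ {n} (ρ : Subcube n) f h → sumOver ρ (λ s → f s + h s) ≡ sumOver ρ f + sumOver ρ h
sumOver-+ []ᵥ            f h = refl
sumOver-+ (nothing ∷ᵥ ρ) f h
  rewrite sumOver-+ ρ (λ s → f (false ∷ᵥ s)) (λ s → h (false ∷ᵥ s))
        | sumOver-+ ρ (λ s → f (true ∷ᵥ s)) (λ s → h (true ∷ᵥ s)) =
  interchange (half f false) (half h false) (half f true) (half h true)
  where
  half : (Vec Bool (suc _) → ℤ) → Bool → ℤ
  half k c = sumOver ρ (λ s → k (c ∷ᵥ s))
sumOver-+ (just b ∷ᵥ ρ)  f h = sumOver-+ ρ (λ s → f (b ∷ᵥ s)) (λ s → h (b ∷ᵥ s))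

sumList-allVec : ∀ n f → sumList f (allVec n) ≡ sumAll n f
sumList-allVec zero    f = ℤ.+-identityʳ (f []ᵥ)
sumList-allVec (suc n) f = begin
  sumList f (allVec (suc n))
    ≡⟨ sumList-pairs (allVec n) ⟩
  sumList (λ s → f (false ∷ᵥ s) + f (true ∷ᵥ s)) (allVec n)
    ≡⟨ sumList-allVec n _ ⟩
  sumAll n (λ s → f (false ∷ᵥ s) + f (true ∷ᵥ s))
    ≡⟨ sumOver-+ (replicate n nothing) _ _ ⟩
  sumAll (suc n) f ∎
  where
  sumList-pairs : ∀ ss → sumList f (concatMap (λ s → (false ∷ᵥ s) ∷ (true ∷ᵥ s) ∷ []) ss)
                         ≡ sumList (λ s → f (false ∷ᵥ s) + f (true ∷ᵥ s)) ss
  sumList-pairs []       = refl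
  sumList-pairs (s ∷ ss) = trans (cong (λ r → f (false ∷ᵥ s) + (f (true ∷ᵥ s) + r)) (sumList-pairs ss))
                                 (sym (ℤ.+-assoc (f (false ∷ᵥ s)) _ _))

OccursIn : List Bool → List Bool → Set
OccursIn P s = ∃₂ λ a c → s ≡ a ++ P ++ c

EndsWith : List Bool → List Bool → Set
EndsWith s y = ∃ λ a → s ≡ a ++ y

eqB-sound : ∀ x y → eqB x y ≡ true → x ≡ y
eqB-sound []          []          _      = refl
eqB-sound (true ∷ x)  (true ∷ y)  x=y    = cong (true ∷_) (eqB-sound x y x=y)
eqB-sound (false ∷ x) (false ∷ y) x=y    = cong (false ∷_) (eqB-sound x y x=y)
eqB-sound []          (_ ∷ _)     ()
eqB-sound (true ∷ _)  []          ()
eqB-sound (true ∷ _)  (false ∷ _) ()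
eqB-sound (false ∷ _) []          ()
eqB-sound (false ∷ _) (true ∷ _)  ()

eqB-refl : ∀ x → eqB x x ≡ true
eqB-refl []          = refl
eqB-refl (true ∷ x)  = eqB-refl x
eqB-refl (false ∷ x) = eqB-refl x

take-length-++ : ∀ {A : Set} (xs ys : List A) → take (length xs) (xs ++ ys) ≡ xs
take-length-++ []       ys = refl
take-length-++ (x ∷ xs) ys = cong (x ∷_) (take-length-++ xs ys)

drop-length-++ : ∀ {A : Set} (xs ys : List A) → drop (length xs) (xs ++ ys) ≡ ys
drop-length-++ []       ys = refl
drop-length-++ (x ∷ xs) ys = drop-length-++ xs ys

length-∷ʳ : ∀ {A : Set} (xs : List A) x → length (xs ∷ʳ x) ≡ suc (length xs)
length-∷ʳ xs x = trans (length-++ xs) (+-comm (length xs) 1)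

prefixB-sound : ∀ P s → prefixB P s ≡ true → ∃ λ c → s ≡ P ++ c
prefixB-sound P s isPrefix = drop (length P) s ,
  trans (sym (take++drop≡id (length P) s)) (cong (_++ drop (length P) s) (eqB-sound _ P isPrefix))

prefixB-++ : ∀ P c → prefixB P (P ++ c) ≡ true
prefixB-++ P c rewrite take-length-++ P c = eqB-refl P

occurs-prefix : ∀ P s → prefixB P s ≡ true → occurs P s ≡ true
occurs-prefix P []      isPrefix = isPrefix
occurs-prefix P (b ∷ s) isPrefix rewrite isPrefix = refl

occurs-sound : ∀ P s → occurs P s ≡ true → OccursIn P s
occurs-sound P []      occ = let c , eq = prefixB-sound P [] occ in [] , c , eq
occurs-sound P (b ∷ s) occ with prefixB P (b ∷ s) in isPrefix
... | true  = let c , eq = prefixB-sound P (b ∷ s) isPrefix in [] , c , eq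
... | false = let a , c , eq = occurs-sound P s occ in b ∷ a , c , cong (b ∷_) eq

occurs-complete : ∀ P {s} → OccursIn P s → occurs P s ≡ true
occurs-complete P ([]    , c , refl) = occurs-prefix P (P ++ c) (prefixB-++ P c)
occurs-complete P (x ∷ a , c , refl) rewrite occurs-complete P (a , c , refl) = ∨-zeroʳ _

occurs-false : ∀ P s → occurs P s ≡ false → ¬ OccursIn P s
occurs-false P s absent occ with () ← trans (sym (occurs-complete P occ)) absent

occurs-∷ʳ : ∀ P l b → occurs P l ≡ true → occurs P (l ∷ʳ b) ≡ true
occurs-∷ʳ P l b occ with a , c , refl ← occurs-sound P l occ =
  occurs-complete P (a , c ∷ʳ b , trans (++-assoc a (P ++ c) [ b ]) (cong (a ++_) (++-assoc P c [ b ])))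

occursIn-∷ʳ-new : ∀ ip e l b → ¬ OccursIn (ip ∷ʳ e) l → OccursIn (ip ∷ʳ e) (l ∷ʳ b) → EndsWith l ip × b ≡ e
occursIn-∷ʳ-new ip e l b absent (a , c , eq) with initLast c
... | [] =
  let l≡aip , b≡e = ∷ʳ-injective l (a ++ ip)
                      (trans eq (trans (cong (a ++_) (++-identityʳ (ip ∷ʳ e))) (sym (++-assoc a ip [ e ]))))
  in (a , l≡aip) , b≡e
... | c′ ∷ʳ′ x = ⊥-elim (absent (a , c′ , proj₁ (∷ʳ-injective l (a ++ (ip ∷ʳ e) ++ c′) (trans eq reassoc))))
  where
  reassoc : a ++ (ip ∷ʳ e) ++ c′ ∷ʳ x ≡ (a ++ (ip ∷ʳ e) ++ c′) ∷ʳ x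
  reassoc = sym (trans (++-assoc a ((ip ∷ʳ e) ++ c′) [ x ]) (cong (a ++_) (++-assoc (ip ∷ʳ e) c′ [ x ])))

occurs-∷ʳ-new : ∀ ip e l b → occurs (ip ∷ʳ e) l ≡ false → occurs (ip ∷ʳ e) (l ∷ʳ b) ≡ true → EndsWith l ip × b ≡ e
occurs-∷ʳ-new ip e l b absent occ = occursIn-∷ʳ-new ip e l b (occurs-false (ip ∷ʳ e) l absent) (occurs-sound _ _ occ)

borderCandidate : List Bool → List Bool → ℕ → ℕ
borderCandidate P s k = if (k ≤ᵇ length P) ∧ eqB (drop (length s ∸ k) s) (take k P) then k else 0

endsWith-drop : ∀ j s y → eqB (drop j s) y ≡ true → EndsWith s y
endsWith-drop j s y suffix =
  take j s , trans (sym (take++drop≡id j s)) (cong (take j s ++_) (eqB-sound _ y suffix))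

borderCandidate-sound : ∀ P s k → borderCandidate P s k ≡ 0 ⊎
                        (borderCandidate P s k ≡ k × k ≤ length P × EndsWith s (take k P))
borderCandidate-sound P s k with k ≤ᵇ length P in k≤∣P∣ | eqB (drop (length s ∸ k) s) (take k P) in suffix
... | true  | true  =
  inj₂ (refl , ≤ᵇ⇒≤ k (length P) (Equivalence.from T-≡ k≤∣P∣) , endsWith-drop (length s ∸ k) s (take k P) suffix)
... | true  | false = inj₁ refl
... | false | _     = inj₁ refl

borderCandidate-complete : ∀ y z a → borderCandidate (y ++ z) (a ++ y) (length y) ≡ length y
borderCandidate-complete y z a
  rewrite length-++ y {z} | Equivalence.to T-≡ (≤⇒≤ᵇ (m≤m+n (length y) (length z)))
        | length-++ a {y} | m+n∸n≡m (length a) (length y)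
        | drop-length-++ a y | take-length-++ y z | eqB-refl y = refl

max : List ℕ → ℕ
max = foldr _⊔_ 0

max< : ∀ {B} xs → 0 < B → All (_< B) xs → max xs < B
max< xs = foldr-preservesᵇ {P = _< _} ⊔-lub

∈⇒≤max : ∀ {x xs} → x ∈ xs → x ≤ max xs
∈⇒≤max {xs = xs} x∈xs = All.lookup bounded x∈xs
  where
  bounded : All (_≤ max xs) xs
  bounded = foldr-forcesᵇ {P = _≤ max xs} (λ x y x⊔y≤ → m⊔n≤o⇒m≤o x y x⊔y≤ , m⊔n≤o⇒n≤o x y x⊔y≤) 0 xs ≤-refl

candidates : List Bool → List Bool → List ℕ
candidates P s = map (borderCandidate P s) (upTo (suc (length s)))

longestSufPre-< : ∀ P s → occurs P s ≡ false → 0 < length P → longestSufPre P s < length P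
longestSufPre-< P s absent 0<∣P∣ =
  max< (candidates P s) 0<∣P∣ (map⁺ (All.universal candidate< (upTo (suc (length s)))))
  where
  candidate< : ∀ k → borderCandidate P s k < length P
  candidate< k with borderCandidate-sound P s k
  ... | inj₁ ≡0 rewrite ≡0 = 0<∣P∣
  ... | inj₂ (≡k , k≤∣P∣ , a , s≡) rewrite ≡k = ≤∧≢⇒< k≤∣P∣ λ { refl →
        occurs-false P s absent (a , [] , trans s≡ (cong (a ++_) (take∣P∣P≡P++[]))) }
    where
    take∣P∣P≡P++[] : take (length P) P ≡ P ++ []
    take∣P∣P≡P++[] = trans (take-all (length P) P ≤-refl) (sym (++-identityʳ P))

candidate≤longestSufPre : ∀ P s k → k ≤ length s → borderCandidate P s k ≡ k → k ≤ longestSufPre P s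
candidate≤longestSufPre P s k k≤∣s∣ isBorder =
  ∈⇒≤max (subst (_∈ candidates P s) isBorder (∈-map⁺ (borderCandidate P s) (∈-upTo⁺ (s≤s k≤∣s∣))))

longestSufPre-attained : ∀ P s → longestSufPre P s ≡ 0 ⊎ ∃ λ k → borderCandidate P s k ≡ longestSufPre P s
longestSufPre-attained P s with foldr-selective ⊔-sel 0 (candidates P s)
... | inj₁ ≡0 = inj₁ ≡0
... | inj₂ ∈cs = let k , _ , eq = ∈-map⁻ (borderCandidate P s) {xs = upTo (suc (length s))} ∈cs in inj₂ (k , sym eq)

longestSufPre-endsWith : ∀ ip e s → longestSufPre (ip ∷ʳ e) s ≡ length ip → EndsWith s ip
longestSufPre-endsWith []       e s _ = s , sym (++-identityʳ s)
longestSufPre-endsWith (x ∷ ip) e s lsp≡ with longestSufPre-attained (x ∷ ip ∷ʳ e) s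
... | inj₁ ≡0 with () ← trans (sym lsp≡) ≡0
... | inj₂ (k , isLsp) with borderCandidate-sound (x ∷ ip ∷ʳ e) s k
...   | inj₁ ≡0 with () ← trans (sym lsp≡) (trans (sym isLsp) ≡0)
...   | inj₂ (≡k , _ , a , s≡) with refl ← trans (sym ≡k) (trans isLsp lsp≡) =
  a , trans s≡ (cong (a ++_) (take-length-++ (x ∷ ip) [ e ]))

endsWith-longestSufPre : ∀ ip e a → occurs (ip ∷ʳ e) (a ++ ip) ≡ false → longestSufPre (ip ∷ʳ e) (a ++ ip) ≡ length ip
endsWith-longestSufPre ip e a absent = ≤-antisym upper lower
  where
  upper : longestSufPre (ip ∷ʳ e) (a ++ ip) ≤ length ip
  upper = <⇒≤pred (subst (longestSufPre (ip ∷ʳ e) (a ++ ip) <_) (length-∷ʳ ip e)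
            (longestSufPre-< (ip ∷ʳ e) (a ++ ip) absent (subst (0 <_) (sym (length-∷ʳ ip e)) (s≤s z≤n))))
  lower : length ip ≤ longestSufPre (ip ∷ʳ e) (a ++ ip)
  lower = candidate≤longestSufPre (ip ∷ʳ e) (a ++ ip) (length ip)
            (subst (length ip ≤_) (sym (length-++ a)) (m≤n+m (length ip) (length a)))
            (borderCandidate-complete ip [ e ] a)

wt-++ : ∀ l r → wt (l ++ r) ≡ wt l ℕ.+ wt r
wt-++ []          r = refl
wt-++ (true ∷ l)  r = cong suc (wt-++ l r)
wt-++ (false ∷ l) r = wt-++ l r

sign-++ : ∀ l r → sign (l ++ r) ≡ sign l * sign r
sign-++ l r = trans (cong (-1ℤ ^_) (wt-++ l r)) (ℤ.^-distribˡ-+-* -1ℤ (wt l) (wt r))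

sign-∷ʳ-cancel : ∀ l → sign (l ∷ʳ false) + sign (l ∷ʳ true) ≡ 0ℤ
sign-∷ʳ-cancel l rewrite sign-++ l [ false ] | sign-++ l [ true ] = cancel (sign l)
  where
  cancel : ∀ x → x * 1ℤ + x * -1ℤ ≡ 0ℤ
  cancel = solve-∀

signIf : Bool → List Bool → ℤ
signIf b s = if b then sign s else 0ℤ

signedState : List Bool → ℕ → List Bool → ℤ
signedState P i s = signIf (kmpState P s ≡ᵇ i) s

≢⇒≡ᵇfalse : ∀ {m n} → m ≢ n → (m ≡ᵇ n) ≡ false
≢⇒≡ᵇfalse {m} {n} m≢n = ¬-not (λ m≡ᵇn → m≢n (≡ᵇ⇒≡ m n (Equivalence.from T-≡ m≡ᵇn)))

≡ᵇ-refl : ∀ n → (n ≡ᵇ n) ≡ true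
≡ᵇ-refl n = Equivalence.to T-≡ (≡⇒≡ᵇ n n refl)

occurs-[] : ∀ s → occurs [] s ≡ true
occurs-[] s = occurs-complete [] (s , [] , sym (++-identityʳ s))

kmpState-accepting : ∀ P s → (kmpState P s ≡ᵇ suc (length P)) ≡ occurs P s
kmpState-accepting []          s rewrite occurs-[] s = refl
kmpState-accepting P@(_ ∷ _) s with occurs P s in occ
... | true  = ≡ᵇ-refl (length P)
... | false = ≢⇒≡ᵇfalse λ eq → <⇒≢ (longestSufPre-< P s occ (s≤s z≤n)) (suc-injective eq)

signedState-accepting : ∀ P s → signedState P (suc (length P)) s ≡ signIf (occurs P s) s
signedState-accepting P s = cong (λ b → signIf b s) (kmpState-accepting P s)

kmpState-occurring : ∀ P s → occurs P s ≡ true → kmpState P s ≡ suc (length P)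
kmpState-occurring P s occ = cong (λ b → if b then suc (length P) else suc (longestSufPre P s)) occ

kmpState-absent : ∀ P s → occurs P s ≡ false → kmpState P s ≡ suc (longestSufPre P s)
kmpState-absent P s absent = cong (λ b → if b then suc (length P) else suc (longestSufPre P s)) absent

module _ (ip : List Bool) (e : Bool) where

  private
    P : List Bool
    P = ip ∷ʳ e

    extension : List Bool → Bool → ℤ
    extension l b = signIf (occurs P (l ∷ʳ b)) (l ∷ʳ b)

    signIf-false : ∀ {b} l → b ≡ false → signIf b l ≡ 0ℤ
    signIf-false l refl = refl

    signIf-true : ∀ {b} l → b ≡ true → signIf b l ≡ sign l
    signIf-true l refl = refl

    step-occurring : ∀ l → occurs P l ≡ true →
                     extension l false + extension l true ≡ sign [ e ] * signedState P (length P) l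
    step-occurring l occ = begin
      extension l false + extension l true
        ≡⟨ cong₂ _+_ (signIf-true (l ∷ʳ false) (occurs-∷ʳ P l false occ))
                     (signIf-true (l ∷ʳ true) (occurs-∷ʳ P l true occ)) ⟩
      sign (l ∷ʳ false) + sign (l ∷ʳ true)
        ≡⟨ sign-∷ʳ-cancel l ⟩
      0ℤ
        ≡⟨ sym (ℤ.*-zeroʳ (sign [ e ])) ⟩
      sign [ e ] * 0ℤ
        ≡⟨ cong (sign [ e ] *_) (sym (signIf-false l notPenultimate)) ⟩
      sign [ e ] * signedState P (length P) l ∎
      where
      notPenultimate : (kmpState P l ≡ᵇ length P) ≡ false
      notPenultimate = trans (cong (_≡ᵇ length P) (kmpState-occurring P l occ)) (≢⇒≡ᵇfalse (1+n≢n {length P}))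

    step-border : ∀ a → occurs P (a ++ ip) ≡ false →
                  extension (a ++ ip) false + extension (a ++ ip) true ≡ sign [ e ] * signedState P (length P) (a ++ ip)
    step-border a absent = begin
      extension l false + extension l true  ≡⟨ sum-over-Bool (extension l) e ⟩
      extension l e + extension l (not e)   ≡⟨ cong₂ _+_ (signIf-true (l ∷ʳ e) completes)
                                                         (signIf-false (l ∷ʳ not e) stays-absent) ⟩
      sign (l ∷ʳ e) + 0ℤ                    ≡⟨ ℤ.+-identityʳ _ ⟩
      sign (l ∷ʳ e)                         ≡⟨ trans (sign-++ l [ e ]) (ℤ.*-comm (sign l) (sign [ e ])) ⟩
      sign [ e ] * sign l                   ≡⟨ cong (sign [ e ] *_) (sym (signIf-true l penultimate)) ⟩
      sign [ e ] * signedState P (length P) l ∎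
      where
      l : List Bool
      l = a ++ ip
      sum-over-Bool : ∀ (f : Bool → ℤ) b → f false + f true ≡ f b + f (not b)
      sum-over-Bool f false = refl
      sum-over-Bool f true  = ℤ.+-comm (f false) (f true)
      completes : occurs P (l ∷ʳ e) ≡ true
      completes = occurs-complete P (a , [] , trans (++-assoc a ip [ e ]) (cong (a ++_) (sym (++-identityʳ P))))
      stays-absent : occurs P (l ∷ʳ not e) ≡ false
      stays-absent = ¬-not λ occ → not-¬ refl (sym (proj₂ (occurs-∷ʳ-new ip e l (not e) absent occ)))
      penultimate : (kmpState P l ≡ᵇ length P) ≡ true
      penultimate = trans (cong₂ _≡ᵇ_ (trans (kmpState-absent P l absent) (cong suc (endsWith-longestSufPre ip e a absent)))
                                      (length-∷ʳ ip e))
                          (≡ᵇ-refl (suc (length ip)))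

    step-elsewhere : ∀ l → occurs P l ≡ false → longestSufPre P l ≢ length ip →
                     extension l false + extension l true ≡ sign [ e ] * signedState P (length P) l
    step-elsewhere l absent notBorder = begin
      extension l false + extension l true
        ≡⟨ cong₂ _+_ (signIf-false (l ∷ʳ false) (stays-absent false))
                     (signIf-false (l ∷ʳ true) (stays-absent true)) ⟩
      0ℤ
        ≡⟨ sym (ℤ.*-zeroʳ (sign [ e ])) ⟩
      sign [ e ] * 0ℤ
        ≡⟨ cong (sign [ e ] *_) (sym (signIf-false l notPenultimate)) ⟩
      sign [ e ] * signedState P (length P) l ∎
      where
      stays-absent : ∀ b → occurs P (l ∷ʳ b) ≡ false
      stays-absent b = ¬-not λ occ → let (a , l≡) , _ = occurs-∷ʳ-new ip e l b absent occ in
        notBorder (subst (λ l → longestSufPre P l ≡ length ip) (sym l≡)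
                         (endsWith-longestSufPre ip e a (subst (λ l → occurs P l ≡ false) l≡ absent)))
      notPenultimate : (kmpState P l ≡ᵇ length P) ≡ false
      notPenultimate = trans (cong₂ _≡ᵇ_ (kmpState-absent P l absent) (length-∷ʳ ip e))
                             (≢⇒≡ᵇfalse (notBorder ∘ suc-injective))

    step : ∀ l o → occurs P l ≡ o → extension l false + extension l true ≡ sign [ e ] * signedState P (length P) l
    step l true  occ = step-occurring l occ
    step l false occ with longestSufPre P l ≟ length ip
    ... | no notBorder = step-elsewhere l occ notBorder
    ... | yes border with a , refl ← longestSufPre-endsWith ip e l border = step-border a occ

  signedState-step : ∀ l → signedState P (suc (length P)) (l ∷ʳ false) + signedState P (suc (length P)) (l ∷ʳ true)
                           ≡ sign [ e ] * signedState P (length P) l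
  signedState-step l = trans (cong₂ _+_ (signedState-accepting P (l ∷ʳ false)) (signedState-accepting P (l ∷ʳ true)))
                             (step l (occurs P l) refl)

valueAt-1-foldr : ∀ {A : Set} (b : A → Bool) (w : A → List Bool) xs →
  valueAt-1 (foldr (λ x acc → if b x then addP (monomial (wt (w x))) acc else acc) [] xs)
    ≡ sumList (λ x → signIf (b x) (w x)) xs
valueAt-1-foldr b w []       = refl
valueAt-1-foldr b w (x ∷ xs) with b x
... | true  = trans (valueAt-1-addP (monomial (wt (w x))) _)
                    (cong₂ _+_ (valueAt-1-monomial (wt (w x))) (valueAt-1-foldr b w xs))
... | false = trans (valueAt-1-foldr b w xs) (sym (ℤ.+-identityˡ _))

valueAt-1-g : ∀ {m} (p : Vec Bool m) n i → valueAt-1 (g p n i) ≡ sumAll n (λ s → signedState (toList p) i (toList s))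
valueAt-1-g p n i =
  trans (valueAt-1-foldr (λ s → kmpState (toList p) (toList s) ≡ᵇ i) toList (allVec n)) (sumList-allVec n _)

kmpState≢0 : ∀ P s → (kmpState P s ≡ᵇ 0) ≡ false
kmpState≢0 P s with occurs P s
... | true  = refl
... | false = refl

valueAt-1-g-initial : ∀ {m} (p : Vec Bool m) n → valueAt-1 (g p n 0) ≡ 0ℤ
valueAt-1-g-initial p n = begin
  valueAt-1 (g p n 0)                                   ≡⟨ valueAt-1-g p n 0 ⟩
  sumAll n (λ s → signedState (toList p) 0 (toList s))  ≡⟨ sumAll-cong n never-initial ⟩
  sumAll n (λ _ → 0ℤ)                                   ≡⟨ sumOver-zero (replicate n nothing) ⟩
  0ℤ                                                    ∎
  where
  never-initial : ∀ s → signedState (toList p) 0 (toList s) ≡ 0ℤ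
  never-initial s = cong (λ b → signIf b (toList s)) (kmpState≢0 (toList p) (toList s))

valueAt-1-g-empty : ∀ n → valueAt-1 (g []ᵥ (suc n) 1) ≡ 0ℤ
valueAt-1-g-empty n = begin
  valueAt-1 (g []ᵥ (suc n) 1)                         ≡⟨ valueAt-1-g []ᵥ (suc n) 1 ⟩
  sumAll (suc n) (λ s → signedState [] 1 (toList s))  ≡⟨ sumAll-cong (suc n) always-accepting ⟩
  sumAll (suc n) (λ s → sign (toList s))              ≡⟨ sumOver-sign (replicate (suc n) nothing) (s≤s z≤n) ⟩
  0ℤ                                                  ∎
  where
  always-accepting : ∀ s → signedState [] 1 (toList s) ≡ sign (toList s)
  always-accepting s = trans (signedState-accepting [] (toList s)) (cong (λ b → signIf b (toList s)) (occurs-[] (toList s)))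

valueAt-1-g-step : ∀ {k} (ys : Vec Bool k) y n →
  valueAt-1 (g (ys ∷ʳᵥ y) (suc n) (suc (suc k))) ≡ sign [ y ] * valueAt-1 (g (ys ∷ʳᵥ y) n (suc k))
valueAt-1-g-step {k} ys y n = begin
  valueAt-1 (g p (suc n) (suc (suc k)))
    ≡⟨ valueAt-1-g p (suc n) (suc (suc k)) ⟩
  sumAll (suc n) (λ s → signedState P (suc (suc k)) (toList s))
    ≡⟨ sumAll-∷ʳ n (λ s → signedState P (suc (suc k)) (toList s)) ⟩
  sumAll n (λ s → signedState P (suc (suc k)) (toList (s ∷ʳᵥ false)) + signedState P (suc (suc k)) (toList (s ∷ʳᵥ true)))
    ≡⟨ sumAll-cong n step ⟩
  sumAll n (λ s → sign [ y ] * signedState P (suc k) (toList s))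
    ≡⟨ sumOver-scale (replicate n nothing) (sign [ y ]) (λ s → signedState P (suc k) (toList s)) ⟩
  sign [ y ] * sumAll n (λ s → signedState P (suc k) (toList s))
    ≡⟨ cong (sign [ y ] *_) (sym (valueAt-1-g p n (suc k))) ⟩
  sign [ y ] * valueAt-1 (g p n (suc k)) ∎
  where
  p : Vec Bool (suc k)
  p = ys ∷ʳᵥ y
  P : List Bool
  P = toList p
  ∣P∣≡ : length (toList ys ∷ʳ y) ≡ suc k
  ∣P∣≡ = trans (length-∷ʳ (toList ys) y) (cong suc (length-toList ys))
  step : ∀ s → signedState P (suc (suc k)) (toList (s ∷ʳᵥ false)) + signedState P (suc (suc k)) (toList (s ∷ʳᵥ true))
               ≡ sign [ y ] * signedState P (suc k) (toList s)
  step s rewrite toList-∷ʳ y ys | toList-∷ʳ false s | toList-∷ʳ true s =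
    subst (λ j → signedState Q (suc j) (l ∷ʳ false) + signedState Q (suc j) (l ∷ʳ true) ≡ sign [ y ] * signedState Q j l)
          ∣P∣≡ (signedState-step (toList ys) y l)
    where
    Q l : List Bool
    Q = toList ys ∷ʳ y
    l = toList s

sign[b]*x≡0⇔x≡0 : ∀ b x → sign [ b ] * x ≡ 0ℤ ⇔ x ≡ 0ℤ
sign[b]*x≡0⇔x≡0 b x = mk⇔
  (λ eq → [ (λ s≡0 → ⊥-elim (sign[b]≢0 b s≡0)) , id ]′ (ℤ.i*j≡0⇒i≡0∨j≡0 (sign [ b ]) eq))
  (λ x≡0 → trans (cong (sign [ b ] *_) x≡0) (ℤ.*-zeroʳ (sign [ b ])))
  where
  sign[b]≢0 : ∀ b → sign [ b ] ≢ 0ℤ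
  sign[b]≢0 true  ()
  sign[b]≢0 false ()

valueAt-1-g≡0⇔ : ∀ m (p : Vec Bool m) n → valueAt-1 (g p (suc n) (suc m)) ≡ 0ℤ ⇔ valueAt-1 (g p n m) ≡ 0ℤ
valueAt-1-g≡0⇔ zero    []ᵥ n = mk⇔ (λ _ → valueAt-1-g-initial []ᵥ n) (λ _ → valueAt-1-g-empty n)
valueAt-1-g≡0⇔ (suc k) p   n with ys , y , refl ← Vec.initLast p rewrite valueAt-1-g-step ys y n =
  sign[b]*x≡0⇔x≡0 y (valueAt-1 (g (ys ∷ʳᵥ y) n (suc k)))

divByXPlus1-g-step : ∀ m (p : Vec Bool m) n → DivByXPlus1 (g p (suc n) (suc m)) ⇔ DivByXPlus1 (g p n m)
divByXPlus1-g-step m p n =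
  ⇔.trans (divByXPlus1⇔valueAt-1≡0 (g p (suc n) (suc m)))
          (⇔.trans (valueAt-1-g≡0⇔ m p n) (⇔.sym (divByXPlus1⇔valueAt-1≡0 (g p n m))))

valueAt-1-g-accepting : ∀ {m} (p : Vec Bool m) n →
  valueAt-1 (g p n (suc m)) ≡ sumAll n (λ s → signIf (occurs (toList p) (toList s)) (toList s))
valueAt-1-g-accepting {m} p n = trans (valueAt-1-g p n (suc m)) (sumAll-cong n accepting)
  where
  accepting : ∀ s → signedState (toList p) (suc m) (toList s) ≡ signIf (occurs (toList p) (toList s)) (toList s)
  accepting s = subst (λ j → signedState (toList p) (suc j) (toList s) ≡ signIf (occurs (toList p) (toList s)) (toList s))
                      (length-toList p) (signedState-accepting (toList p) (toList s))

acceptSum : ∀ {n} → DTree n → Subcube n → ℤ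
acceptSum t ρ = sumOver ρ (λ s → signIf (eval t s) (toList s))

Shallow : ∀ {n} → DTree n → Subcube n → Set
Shallow t ρ = ∀ s → s ∈ᶜ ρ → queries t s < dim ρ

Vanishes : ∀ {n} → DTree n → Set
Vanishes t = ∀ ρ → Shallow t ρ → acceptSum t ρ ≡ 0ℤ

branch : ∀ {n} → Bool → DTree n → DTree n → DTree n
branch b t₀ t₁ = if b then t₁ else t₀

eval-query : ∀ {n} i (t₀ t₁ : DTree n) s {b} → lookup s i ≡ b → eval (query i t₀ t₁) s ≡ eval (branch b t₀ t₁) s
eval-query i t₀ t₁ s {true}  sᵢ≡b rewrite sᵢ≡b = refl
eval-query i t₀ t₁ s {false} sᵢ≡b rewrite sᵢ≡b = refl

queries-query : ∀ {n} i (t₀ t₁ : DTree n) s {b} → lookup s i ≡ b → queries (query i t₀ t₁) s ≡ suc (queries (branch b t₀ t₁) s)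
queries-query i t₀ t₁ s {true}  sᵢ≡b rewrite sᵢ≡b = refl
queries-query i t₀ t₁ s {false} sᵢ≡b rewrite sᵢ≡b = refl

vanishes-leaf : ∀ {n} b → Vanishes {n} (leaf b)
vanishes-leaf false ρ _       = sumOver-zero ρ
vanishes-leaf true  ρ shallow = let s , s∈ρ = subcube-inhabited ρ in sumOver-sign ρ (shallow s s∈ρ)

module _ {n} (i : Fin n) (t₀ t₁ : DTree n) (v₀ : Vanishes t₀) (v₁ : Vanishes t₁) where

  private
    vanishes-branch : ∀ b → Vanishes (branch b t₀ t₁)
    vanishes-branch false = v₀
    vanishes-branch true  = v₁

    vanishes-fixed : ∀ ρ b → (∀ s → s ∈ᶜ ρ → lookup s i ≡ b) → Shallow (branch b t₀ t₁) ρ → acceptSum (query i t₀ t₁) ρ ≡ 0ℤ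
    vanishes-fixed ρ b fixed shallow =
      trans (sumOver-cong ρ (λ s s∈ρ → cong (λ a → signIf a (toList s)) (eval-query i t₀ t₁ s (fixed s s∈ρ))))
            (vanishes-branch b ρ shallow)

    vanishes-half : ∀ ρ b → lookup ρ i ≡ nothing → Shallow (query i t₀ t₁) ρ → acceptSum (query i t₀ t₁) (fix ρ i b) ≡ 0ℤ
    vanishes-half ρ b ρᵢ≡∅ shallow = vanishes-fixed (fix ρ i b) b (λ s s∈ → proj₂ (∈ᶜ-fix ρ i b s ρᵢ≡∅ s∈)) λ s s∈ →
      let s∈ρ , sᵢ≡b = ∈ᶜ-fix ρ i b s ρᵢ≡∅ s∈
      in ≤-pred (subst₂ _<_ (queries-query i t₀ t₁ s sᵢ≡b) (dim-fix ρ i b ρᵢ≡∅) (shallow s s∈ρ))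

  vanishes-query : Vanishes (query i t₀ t₁)
  vanishes-query ρ shallow with lookup ρ i in ρᵢ
  ... | just b  = vanishes-fixed ρ b (λ s → lookup-∈ᶜ ρ i s ρᵢ) λ s s∈ρ →
                    <-trans (n<1+n _) (subst (_< dim ρ) (queries-query i t₀ t₁ s (lookup-∈ᶜ ρ i s ρᵢ s∈ρ)) (shallow s s∈ρ))
  ... | nothing = trans (sumOver-split ρ i _ ρᵢ) (cong₂ _+_ (vanishes-half ρ false ρᵢ shallow) (vanishes-half ρ true ρᵢ shallow))

acceptSum-vanishes : ∀ {n} (t : DTree n) → Vanishes t
acceptSum-vanishes (leaf b)        = vanishes-leaf b
acceptSum-vanishes (query i t₀ t₁) = vanishes-query i t₀ t₁ (acceptSum-vanishes t₀) (acceptSum-vanishes t₁)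

liftTree : ∀ {n} → DTree n → DTree (suc n)
liftTree (leaf b)        = leaf b
liftTree (query i t₀ t₁) = query (suc i) (liftTree t₀) (liftTree t₁)

eval-liftTree : ∀ {n} (t : DTree n) b s → eval (liftTree t) (b ∷ᵥ s) ≡ eval t s
eval-liftTree (leaf _)        b s = refl
eval-liftTree (query i t₀ t₁) b s with lookup s i
... | true  = eval-liftTree t₁ b s
... | false = eval-liftTree t₀ b s

queries-liftTree : ∀ {n} (t : DTree n) b s → queries (liftTree t) (b ∷ᵥ s) ≡ queries t s
queries-liftTree (leaf _)        b s = refl
queries-liftTree (query i t₀ t₁) b s with lookup s i
... | true  = cong suc (queries-liftTree t₁ b s)
... | false = cong suc (queries-liftTree t₀ b s)

fullTree : ∀ n → (Vec Bool n → Bool) → DTree n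
fullTree zero    f = leaf (f []ᵥ)
fullTree (suc n) f = query zero (liftTree (fullTree n (f ∘ (false ∷ᵥ_)))) (liftTree (fullTree n (f ∘ (true ∷ᵥ_))))

eval-fullTree : ∀ n f s → eval (fullTree n f) s ≡ f s
eval-fullTree zero    f []ᵥ      = refl
eval-fullTree (suc n) f (b ∷ᵥ s) with b
... | true  = trans (eval-liftTree (fullTree n (f ∘ (true ∷ᵥ_))) true s) (eval-fullTree n (f ∘ (true ∷ᵥ_)) s)
... | false = trans (eval-liftTree (fullTree n (f ∘ (false ∷ᵥ_))) false s) (eval-fullTree n (f ∘ (false ∷ᵥ_)) s)

queries-fullTree : ∀ n f s → queries (fullTree n f) s ≡ n
queries-fullTree zero    f []ᵥ      = refl
queries-fullTree (suc n) f (b ∷ᵥ s) with b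
... | true  = cong suc (trans (queries-liftTree (fullTree n (f ∘ (true ∷ᵥ_))) true s)
                             (queries-fullTree n (f ∘ (true ∷ᵥ_)) s))
... | false = cong suc (trans (queries-liftTree (fullTree n (f ∘ (false ∷ᵥ_))) false s)
                             (queries-fullTree n (f ∘ (false ∷ᵥ_)) s))

∃?-Vec : ∀ n {Q : Vec Bool n → Set} → (∀ s → Dec (Q s)) → Dec (∃ Q)
∃?-Vec zero    Q? = map′ ([]ᵥ ,_) (λ { ([]ᵥ , q) → q }) (Q? []ᵥ)
∃?-Vec (suc n) Q? = map′ (λ { (inj₁ (s , q)) → false ∷ᵥ s , q ; (inj₂ (s , q)) → true ∷ᵥ s , q })
                         (λ { (false ∷ᵥ s , q) → inj₁ (s , q) ; (true ∷ᵥ s , q) → inj₂ (s , q) })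
                         (∃?-Vec n (Q? ∘ (false ∷ᵥ_)) ⊎-dec ∃?-Vec n (Q? ∘ (true ∷ᵥ_)))

shallow-correct-tree⇒divisible : ∀ {m} (p : Vec Bool m) n (t : DTree n) → Decides p t → (∀ s → queries t s < n) →
                                  DivByXPlus1 (g p n (suc m))
shallow-correct-tree⇒divisible p n t decides shallow = Equivalence.from (divByXPlus1⇔valueAt-1≡0 (g p n _)) (begin
  valueAt-1 (g p n _)
    ≡⟨ valueAt-1-g-accepting p n ⟩
  sumAll n (λ s → signIf (occurs (toList p) (toList s)) (toList s))
    ≡⟨ sumAll-cong n (λ s → cong (λ b → signIf b (toList s)) (sym (decides s))) ⟩
  acceptSum t (replicate n nothing)
    ≡⟨ acceptSum-vanishes t (replicate n nothing) (λ s _ → subst (queries t s <_) (sym (dim-replicate n)) (shallow s)) ⟩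
  0ℤ ∎)

evasive : ∀ m (p : Vec Bool m) → (∃ λ N₀ → ∀ n → N₀ < n → ¬ DivByXPlus1 (g p n m)) → Evasive p
evasive m p (N₀ , nondivisible) = suc N₀ , λ { (suc n) (s≤s N₀<n) → upper (suc n) , lower n N₀<n }
  where
  upper : ∀ n → ∃ λ (t : DTree n) → Decides p t × (∀ s → queries t s ≤ n)
  upper n = fullTree n F , eval-fullTree n F , λ s → ≤-reflexive (queries-fullTree n F s)
    where
    F : Vec Bool n → Bool
    F s = occurs (toList p) (toList s)
  lower : ∀ n → N₀ < n → ∀ t → Decides p t → ∃ λ s → suc n ≤ queries t s
  lower n N₀<n t decides with ∃?-Vec (suc n) (λ s → suc n ≤? queries t s)
  ... | yes deep = deep
  ... | no  none = ⊥-elim (nondivisible n N₀<n (Equivalence.to (divByXPlus1-g-step m p n)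
                     (shallow-correct-tree⇒divisible p (suc n) t decides (λ s → ≰⇒> (λ deep → none (s , deep))))))

lemma8 : (m : ℕ) (p : Vec Bool m) →
           (∀ n → DivByXPlus1 (g p (suc n) (suc m)) ⇔ DivByXPlus1 (g p n m)) ×
           ((∃ λ N₀ → ∀ n → N₀ < n → ¬ DivByXPlus1 (g p n m)) → Evasive p)
lemma8 m p = divByXPlus1-g-step m p , evasive m p
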